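{- Let $R$ be a commutative ring, $M$ an $R$-module, and $a\in M^{\mathbb{N}}$ an $R$-recurrence sequence of order $d$. If $a(k)=a(k+m)=a(k+2m)=\cdots=a(k+(d-1)m)=0$ for some $k\in\mathbb{N}$ and some positive integer $m$, then $a(k+im)=0$ for all $i\in\mathbb{N}$.
   Context: $\mathbb{N}=\{0,1,2,\dots\}$. $a$ is an $R$-recurrence sequence of order $\le d$ if there are $\gamma_0,\dots,\gamma_{d-1}\in R$ with $a(n+d)=\gamma_{d-1}a(n+d-1)+\cdots+\gamma_0a(n)$ for all $n$; the order is the least such $d$. -}

module Defs where

open import Level using (Level; _⊔_)
open import Data.Nat using (ℕ; zero; suc; _+_; _*_; _<_)
open import Data.Fin using (Fin; toℕ)
import Data.Fin as F
open import Data.Product using (Σ; _×_)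
open import Relation.Nullary using (¬_)
open import Algebra.Bundles using (CommutativeRing)
open import Algebra.Module.Bundles using (Module)

module _ {r ℓr m ℓm : Level} {R : CommutativeRing r ℓr} (M : Module R m ℓm) where
  open CommutativeRing R using () renaming (Carrier to Rc)
  open Module M

  sumᴹ : (d : ℕ) → (Fin d → Carrierᴹ) → Carrierᴹ
  sumᴹ zero    f = 0ᴹ
  sumᴹ (suc d) f = f F.zero +ᴹ sumᴹ d (λ j → f (F.suc j))

  IsRecOfOrder≤ : (ℕ → Carrierᴹ) → ℕ → Set (r ⊔ ℓm)
  IsRecOfOrder≤ a d =
    Σ (Fin d → Rc) λ γ → ∀ n → a (n + d) ≈ᴹ sumᴹ d (λ j → γ j *ₗ a (n + toℕ j))

  HasRecOrder : (ℕ → Carrierᴹ) → ℕ → Set (r ⊔ ℓm)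
  HasRecOrder a d = IsRecOfOrder≤ a d × (∀ d' → d' < d → ¬ IsRecOfOrder≤ a d')

-- Every shift n ↦ a (n + N) is an R-linear combination of the shifts by 0, …, d − 1. Hence the
-- d sequences wᵣ (i) = a (r + k + i m), r < d, satisfy w (i + 1) = Y w (i) for some d × d matrix Y
-- over R. Polynomials in the shift E act on M-valued sequences and form a commutative ring, over
-- which (E · 1 − Y) w = 0; Cramer's rule gives det (E · 1 − Y) w₀ = 0. This determinant is monic of
-- degree d, so i ↦ a (k + i m) satisfies a recurrence of order ≤ d, and d consecutive zeros make it
-- vanish.

module Submission where

open import Defs
open import Data.Nat using (ℕ; zero; suc)
open import Level using (Level; _⊔_)
open import Relation.Binary.Structures using (IsEquivalence)
open import Algebra.Structures using (IsAbelianGroup)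
import Algebra.Construct.Pointwise as Pointwise
open import Data.List using (List; []; _∷_; _++_; [_]; length)
open import Data.List.Properties using (++-assoc)
open import Data.List.Membership.Propositional using (_∈_)
open import Data.List.Membership.Propositional.Properties using (∈-∃++)
open import Data.List.Relation.Unary.Any using (here; there)
open import Data.Product using (Σ; _×_; _,_; proj₁; proj₂)
open import Relation.Binary.PropositionalEquality as ≡ using (_≡_; _≢_)
open import Algebra.Bundles using (AbelianGroup; Semiring; Ring; CommutativeRing)
open import Algebra.Module.Bundles using (LeftModule; Module)
import Relation.Binary.Reasoning.Setoid as SetoidReasoning

module AbelianGroupProperties {a ℓ} (G : AbelianGroup a ℓ) where
  open AbelianGroup G
  open import Algebra.Properties.AbelianGroup G using (⁻¹-anti-homo‿-; ⁻¹-∙-comm)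
  open import Algebra.Properties.CommutativeSemigroup commutativeSemigroup using (interchange)
  open SetoidReasoning setoid

  x-[y-z]≈[x-y]+z : ∀ x y z → x - (y - z) ≈ (x - y) ∙ z
  x-[y-z]≈[x-y]+z x y z = begin
    x ∙ (y - z) ⁻¹ ≈⟨ ∙-congˡ (⁻¹-anti-homo‿- y z) ⟩
    x ∙ (z - y)    ≈⟨ ∙-congˡ (comm z (y ⁻¹)) ⟩
    x ∙ (y ⁻¹ ∙ z) ≈⟨ assoc x (y ⁻¹) z ⟨
    (x - y) ∙ z    ∎

  x≈y∧z≈ε⇒x-[y-z]≈ε : ∀ {x y z} → x ≈ y → z ≈ ε → x - (y - z) ≈ ε
  x≈y∧z≈ε⇒x-[y-z]≈ε {x} {y} {z} x≈y z≈ε = begin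
    x - (y - z) ≈⟨ x-[y-z]≈[x-y]+z x y z ⟩
    (x - y) ∙ z ≈⟨ ∙-cong (∙-congʳ x≈y) z≈ε ⟩
    (y - y) ∙ ε ≈⟨ identityʳ _ ⟩
    y - y       ≈⟨ inverseʳ y ⟩
    ε           ∎

  z≈w⁻¹⇒x-[y-z]≈[y-[x-w]]⁻¹ : ∀ {x y z w} → z ≈ w ⁻¹ → x - (y - z) ≈ (y - (x - w)) ⁻¹
  z≈w⁻¹⇒x-[y-z]≈[y-[x-w]]⁻¹ {x} {y} {z} {w} z≈w⁻¹ = begin
    x - (y - z)         ≈⟨ x-[y-z]≈[x-y]+z x y z ⟩
    (x - y) ∙ z         ≈⟨ ∙-cong (sym (⁻¹-anti-homo‿- y x)) z≈w⁻¹ ⟩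
    (y - x) ⁻¹ ∙ w ⁻¹   ≈⟨ ⁻¹-∙-comm (y - x) w ⟩
    ((y - x) ∙ w) ⁻¹    ≈⟨ ⁻¹-cong (x-[y-z]≈[x-y]+z y x w) ⟨
    (y - (x - w)) ⁻¹    ∎

  [x+y]-[u+v]≈[x-u]+[y-v] : ∀ x y u v → (x ∙ y) - (u ∙ v) ≈ (x - u) ∙ (y - v)
  [x+y]-[u+v]≈[x-u]+[y-v] x y u v = begin
    (x ∙ y) ∙ (u ∙ v) ⁻¹    ≈⟨ ∙-congˡ (⁻¹-∙-comm u v) ⟨
    (x ∙ y) ∙ (u ⁻¹ ∙ v ⁻¹) ≈⟨ interchange x y (u ⁻¹) (v ⁻¹) ⟩
    (x - u) ∙ (y - v)       ∎

  [x+y]-z≈[x-z]+y : ∀ x y z → (x ∙ y) - z ≈ (x - z) ∙ y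
  [x+y]-z≈[x-z]+y x y z = begin
    (x ∙ y) ∙ z ⁻¹ ≈⟨ assoc x y (z ⁻¹) ⟩
    x ∙ (y ∙ z ⁻¹) ≈⟨ ∙-congˡ (comm y (z ⁻¹)) ⟩
    x ∙ (z ⁻¹ ∙ y) ≈⟨ assoc x (z ⁻¹) y ⟨
    (x - z) ∙ y    ∎

module SemiringProperties {a ℓ} (S : Semiring a ℓ) where
  open Semiring S
  open SetoidReasoning setoid

  [a+b][x+y]≈ax+ay+bx+by : ∀ a b x y → (a + b) * (x + y) ≈ a * x + a * y + b * x + b * y
  [a+b][x+y]≈ax+ay+bx+by a b x y = begin
    (a + b) * (x + y)                 ≈⟨ distribʳ (x + y) a b ⟩
    a * (x + y) + b * (x + y)         ≈⟨ +-cong (distribˡ a x y) (distribˡ b x y) ⟩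
    (a * x + a * y) + (b * x + b * y) ≈⟨ +-assoc _ _ _ ⟨
    a * x + a * y + b * x + b * y     ∎

module RingProperties {a ℓ} (R : Ring a ℓ) where
  open Ring R
  open import Algebra.Properties.Ring R using (-0#≈0#; -‿distribʳ-*; -‿+-comm)

  x*0-0≈0 : ∀ x → x * 0# - 0# ≈ 0#
  x*0-0≈0 x = trans (+-cong (zeroʳ x) -0#≈0#) (+-identityʳ 0#)

  x[-y]-[-z]≈-[xy-z] : ∀ x y z → x * (- y) - (- z) ≈ - (x * y - z)
  x[-y]-[-z]≈-[xy-z] x y z = trans (+-congʳ (sym (-‿distribʳ-* x y))) (-‿+-comm (x * y) (- z))

module LeftModuleProperties {r ℓr m ℓm} {R : Ring r ℓr} (N : LeftModule R m ℓm) where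
  open Ring R
  open LeftModule N
  open import Algebra.Module.Properties.LeftModule N using (inverseˡ-uniqueᴹ)
  open import Algebra.Properties.AbelianGroup +ᴹ-abelianGroup using (ε⁻¹≈ε; ⁻¹-∙-comm)
  open import Algebra.Properties.CommutativeSemigroup (AbelianGroup.commutativeSemigroup +ᴹ-abelianGroup)
    using (interchange)
  open SetoidReasoning ≈ᴹ-setoid

  -‿distribˡ-*ₗ : ∀ a x → (- a) *ₗ x ≈ᴹ -ᴹ (a *ₗ x)
  -‿distribˡ-*ₗ a x = inverseˡ-uniqueᴹ _ _ (begin
    (- a) *ₗ x +ᴹ a *ₗ x ≈⟨ *ₗ-distribʳ x (- a) a ⟨
    (- a + a) *ₗ x       ≈⟨ *ₗ-congʳ (-‿inverseˡ a) ⟩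
    0# *ₗ x              ≈⟨ *ₗ-zeroˡ x ⟩
    0ᴹ                   ∎)

  -ᴹ‿distribʳ-*ₗ : ∀ a x → a *ₗ (-ᴹ x) ≈ᴹ -ᴹ (a *ₗ x)
  -ᴹ‿distribʳ-*ₗ a x = inverseˡ-uniqueᴹ _ _ (begin
    a *ₗ (-ᴹ x) +ᴹ a *ₗ x ≈⟨ *ₗ-distribˡ a (-ᴹ x) x ⟨
    a *ₗ (-ᴹ x +ᴹ x)      ≈⟨ *ₗ-congˡ (-ᴹ‿inverseˡ x) ⟩
    a *ₗ 0ᴹ               ≈⟨ *ₗ-zeroʳ a ⟩
    0ᴹ                    ∎)

  [a-b]*ₗx≈a*ₗx-b*ₗx : ∀ a b x → (a - b) *ₗ x ≈ᴹ a *ₗ x +ᴹ -ᴹ (b *ₗ x)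
  [a-b]*ₗx≈a*ₗx-b*ₗx a b x = ≈ᴹ-trans (*ₗ-distribʳ x a (- b)) (+ᴹ-congˡ (-‿distribˡ-*ₗ b x))

  ∑ : ∀ {i} {I : Set i} → List I → (I → Carrierᴹ) → Carrierᴹ
  ∑ []       f = 0ᴹ
  ∑ (c ∷ cs) f = f c +ᴹ ∑ cs f

  infix 5 ∑
  syntax ∑ L (λ c → e) = ∑[ c ∈ L ] e

  module _ {i} {I : Set i} where

    ∑-cong : ∀ (L : List I) {f g} → (∀ c → c ∈ L → f c ≈ᴹ g c) → ∑ L f ≈ᴹ ∑ L g
    ∑-cong []      f≈g = ≈ᴹ-refl
    ∑-cong (c ∷ L) f≈g = +ᴹ-cong (f≈g c (here ≡.refl)) (∑-cong L (λ c′ c′∈L → f≈g c′ (there c′∈L)))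

    ∑-zero : ∀ (L : List I) {f} → (∀ c → c ∈ L → f c ≈ᴹ 0ᴹ) → ∑ L f ≈ᴹ 0ᴹ
    ∑-zero L {f} f≈0 = ≈ᴹ-trans (∑-cong L f≈0) (∑-const-0 L)
      where
      ∑-const-0 : ∀ (L : List I) → ∑[ c ∈ L ] 0ᴹ ≈ᴹ 0ᴹ
      ∑-const-0 []      = ≈ᴹ-refl
      ∑-const-0 (c ∷ L) = ≈ᴹ-trans (+ᴹ-identityˡ _) (∑-const-0 L)

    ∑-distrib-+ᴹ : ∀ (L : List I) f g → ∑[ c ∈ L ] (f c +ᴹ g c) ≈ᴹ ∑ L f +ᴹ ∑ L g
    ∑-distrib-+ᴹ []      f g = ≈ᴹ-sym (+ᴹ-identityˡ 0ᴹ)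
    ∑-distrib-+ᴹ (c ∷ L) f g = ≈ᴹ-trans (+ᴹ-congˡ (∑-distrib-+ᴹ L f g)) (interchange _ _ _ _)

    -ᴹ‿distrib-∑ : ∀ (L : List I) f → -ᴹ ∑ L f ≈ᴹ ∑[ c ∈ L ] -ᴹ f c
    -ᴹ‿distrib-∑ []      f = ε⁻¹≈ε
    -ᴹ‿distrib-∑ (c ∷ L) f = ≈ᴹ-trans (≈ᴹ-sym (⁻¹-∙-comm _ _)) (+ᴹ-congˡ (-ᴹ‿distrib-∑ L f))

    *ₗ-distribˡ-∑ : ∀ a (L : List I) f → a *ₗ ∑ L f ≈ᴹ ∑[ c ∈ L ] a *ₗ f c
    *ₗ-distribˡ-∑ a []      f = *ₗ-zeroʳ a
    *ₗ-distribˡ-∑ a (c ∷ L) f = ≈ᴹ-trans (*ₗ-distribˡ a _ _) (+ᴹ-congˡ (*ₗ-distribˡ-∑ a L f))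

  ∑-comm : ∀ {i j} {I : Set i} {J : Set j} (L : List I) (L′ : List J) (f : I → J → Carrierᴹ) →
           ∑[ c ∈ L ] ∑[ c′ ∈ L′ ] f c c′ ≈ᴹ ∑[ c′ ∈ L′ ] ∑[ c ∈ L ] f c c′
  ∑-comm []      L′ f = ≈ᴹ-sym (∑-zero L′ (λ _ _ → ≈ᴹ-refl))
  ∑-comm (c ∷ L) L′ f = begin
    (∑[ c′ ∈ L′ ] f c c′) +ᴹ (∑[ d ∈ L ] ∑[ c′ ∈ L′ ] f d c′) ≈⟨ +ᴹ-congˡ (∑-comm L L′ f) ⟩
    (∑[ c′ ∈ L′ ] f c c′) +ᴹ (∑[ c′ ∈ L′ ] ∑[ d ∈ L ] f d c′) ≈⟨ ∑-distrib-+ᴹ L′ _ _ ⟨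
    ∑[ c′ ∈ L′ ] (f c c′ +ᴹ (∑[ d ∈ L ] f d c′))              ∎

module Determinant {c ℓ} (S : CommutativeRing c ℓ) {i} {I : Set i}
                   (A : I → I → CommutativeRing.Carrier S) where
  open CommutativeRing S
  open import Algebra.Properties.Ring ring using (-0#≈0#)
  open AbelianGroupProperties +-abelianGroup using (x≈y∧z≈ε⇒x-[y-z]≈ε; z≈w⁻¹⇒x-[y-z]≈[y-[x-w]]⁻¹)
  open RingProperties ring using (x*0-0≈0; x[-y]-[-z]≈-[xy-z])
  open SetoidReasoning setoid

  -- Laplace expansion along the first row: expand r rs pre (c₀ ∷ … ∷ cₙ) is
  -- Σⱼ (-1)ʲ A r cⱼ · det rs (pre ++ [c₀, …, cₙ] with cⱼ removed), pre being the columns already passed.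
  mutual
    det : List I → List I → Carrier
    det []       []      = 1#
    det []       (_ ∷ _) = 0#
    det (r ∷ rs) cs      = expand r rs [] cs

    expand : I → List I → List I → List I → Carrier
    expand r rs pre []       = 0#
    expand r rs pre (c ∷ cs) = A r c * det rs (pre ++ cs) - expand r rs (pre ++ [ c ]) cs

  det-≡ : ∀ rs {xs ys} → xs ≡ ys → det rs xs ≈ det rs ys
  det-≡ rs xs≡ys = reflexive (≡.cong (det rs) xs≡ys)

  module _ (r : I) (rs : List I) where

    expand-zero-prefix : ∀ xs ys → (∀ zs → det rs (xs ++ zs) ≈ 0#) → expand r rs xs ys ≈ 0#
    expand-zero-prefix xs []       _    = refl
    expand-zero-prefix xs (y ∷ ys) det≈0 = trans
      (+-cong (*-congˡ (det≈0 ys)) (-‿cong (expand-zero-prefix (xs ++ [ y ]) ys λ zs →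
         trans (det-≡ rs (++-assoc xs [ y ] zs)) (det≈0 (y ∷ zs)))))
      (x*0-0≈0 _)

    expand-neg-prefix : ∀ xs xs′ ys → (∀ zs → det rs (xs ++ zs) ≈ - det rs (xs′ ++ zs)) →
                        expand r rs xs ys ≈ - expand r rs xs′ ys
    expand-neg-prefix xs xs′ []       _     = sym -0#≈0#
    expand-neg-prefix xs xs′ (y ∷ ys) det≈- = trans
      (+-cong (*-congˡ (det≈- ys)) (-‿cong (expand-neg-prefix (xs ++ [ y ]) (xs′ ++ [ y ]) ys λ zs →
         trans (det-≡ rs (++-assoc xs [ y ] zs))
               (trans (det≈- (y ∷ zs)) (-‿cong (det-≡ rs (≡.sym (++-assoc xs′ [ y ] zs))))))))
      (x[-y]-[-z]≈-[xy-z] _ _ _)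

  det-adjacent-equal : ∀ rs xs f ys → det rs (xs ++ f ∷ f ∷ ys) ≈ 0#
  det-adjacent-equal []       []       f ys = refl
  det-adjacent-equal []       (_ ∷ _)  f ys = refl
  det-adjacent-equal (r ∷ rs) xs       f ys = expand-adjacent-equal [] xs
    where
    expand-adjacent-equal : ∀ pre xs → expand r rs pre (xs ++ f ∷ f ∷ ys) ≈ 0#
    expand-adjacent-equal pre (x ∷ xs) = trans
      (+-cong (*-congˡ (trans (det-≡ rs (≡.sym (++-assoc pre xs _))) (det-adjacent-equal rs (pre ++ xs) f ys)))
              (-‿cong (expand-adjacent-equal (pre ++ [ x ]) xs)))
      (x*0-0≈0 _)
    expand-adjacent-equal pre [] = x≈y∧z≈ε⇒x-[y-z]≈ε
      (*-congˡ (det-≡ rs (≡.sym (++-assoc pre [ f ] ys))))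
      (expand-zero-prefix r rs ((pre ++ [ f ]) ++ [ f ]) ys λ zs →
        trans (det-≡ rs (≡.trans (++-assoc (pre ++ [ f ]) [ f ] zs) (++-assoc pre [ f ] (f ∷ zs))))
              (det-adjacent-equal rs pre f zs))

  det-adjacent-swap : ∀ rs xs f g ys → det rs (xs ++ f ∷ g ∷ ys) ≈ - det rs (xs ++ g ∷ f ∷ ys)
  det-adjacent-swap []       []       f g ys = sym -0#≈0#
  det-adjacent-swap []       (_ ∷ _)  f g ys = sym -0#≈0#
  det-adjacent-swap (r ∷ rs) xs       f g ys = expand-adjacent-swap [] xs
    where
    swap-after : ∀ pre xs → det rs (pre ++ xs ++ f ∷ g ∷ ys) ≈ - det rs (pre ++ xs ++ g ∷ f ∷ ys)
    swap-after pre xs = begin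
      det rs (pre ++ xs ++ f ∷ g ∷ ys)     ≈⟨ det-≡ rs (≡.sym (++-assoc pre xs _)) ⟩
      det rs ((pre ++ xs) ++ f ∷ g ∷ ys)   ≈⟨ det-adjacent-swap rs (pre ++ xs) f g ys ⟩
      - det rs ((pre ++ xs) ++ g ∷ f ∷ ys) ≈⟨ -‿cong (det-≡ rs (++-assoc pre xs _)) ⟩
      - det rs (pre ++ xs ++ g ∷ f ∷ ys)   ∎

    expand-adjacent-swap : ∀ pre xs → expand r rs pre (xs ++ f ∷ g ∷ ys) ≈ - expand r rs pre (xs ++ g ∷ f ∷ ys)
    expand-adjacent-swap pre (x ∷ xs) = trans
      (+-cong (*-congˡ (swap-after pre xs)) (-‿cong (expand-adjacent-swap (pre ++ [ x ]) xs)))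
      (x[-y]-[-z]≈-[xy-z] _ _ _)
    expand-adjacent-swap pre [] = begin
      A r f * det rs (pre ++ g ∷ ys) - (A r g * det rs ((pre ++ [ f ]) ++ ys) - expand r rs ((pre ++ [ f ]) ++ [ g ]) ys)
        ≈⟨ +-congˡ (-‿cong (+-congʳ (*-congˡ (det-≡ rs (++-assoc pre [ f ] ys))))) ⟩
      A r f * det rs (pre ++ g ∷ ys) - (A r g * det rs (pre ++ f ∷ ys) - expand r rs ((pre ++ [ f ]) ++ [ g ]) ys)
        ≈⟨ z≈w⁻¹⇒x-[y-z]≈[y-[x-w]]⁻¹ (expand-neg-prefix r rs ((pre ++ [ f ]) ++ [ g ]) ((pre ++ [ g ]) ++ [ f ]) ys λ zs →
             trans (det-≡ rs (≡.trans (++-assoc (pre ++ [ f ]) [ g ] zs) (++-assoc pre [ f ] (g ∷ zs))))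
               (trans (det-adjacent-swap rs pre f g zs)
                 (-‿cong (det-≡ rs (≡.sym (≡.trans (++-assoc (pre ++ [ g ]) [ f ] zs) (++-assoc pre [ g ] (f ∷ zs)))))))) ⟩
      - (A r g * det rs (pre ++ f ∷ ys) - (A r f * det rs (pre ++ g ∷ ys) - expand r rs ((pre ++ [ g ]) ++ [ f ]) ys))
        ≈⟨ -‿cong (+-congˡ (-‿cong (+-congʳ (*-congˡ (det-≡ rs (++-assoc pre [ g ] ys)))))) ⟨
      - (A r g * det rs (pre ++ f ∷ ys) - (A r f * det rs ((pre ++ [ g ]) ++ ys) - expand r rs ((pre ++ [ g ]) ++ [ f ]) ys)) ∎

  det-repeated-col : ∀ rs xs f zs ys → det rs (xs ++ f ∷ zs ++ f ∷ ys) ≈ 0#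
  det-repeated-col rs xs f []       ys = det-adjacent-equal rs xs f ys
  det-repeated-col rs xs f (z ∷ zs) ys = begin
    det rs (xs ++ f ∷ z ∷ zs ++ f ∷ ys)           ≈⟨ det-adjacent-swap rs xs f z _ ⟩
    - det rs (xs ++ z ∷ f ∷ zs ++ f ∷ ys)         ≈⟨ -‿cong (det-≡ rs (≡.sym (++-assoc xs [ z ] _))) ⟩
    - det rs ((xs ++ [ z ]) ++ f ∷ zs ++ f ∷ ys)  ≈⟨ -‿cong (det-repeated-col rs (xs ++ [ z ]) f zs ys) ⟩
    - 0#                                          ≈⟨ -0#≈0# ⟩
    0#                                            ∎

  det-∈-col : ∀ rs {c cs} → c ∈ cs → det rs (c ∷ cs) ≈ 0#
  det-∈-col rs c∈cs with xs , ys , ≡.refl ← ∈-∃++ c∈cs = det-repeated-col rs [] _ xs ys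

module Cramer {c ℓ} (S : CommutativeRing c ℓ) {i} {I : Set i} (A : I → I → CommutativeRing.Carrier S)
              {m ℓm} (N : LeftModule (CommutativeRing.ring S) m ℓm) where
  open CommutativeRing S using (_*_; _-_; *-comm)
  open Determinant S A
  open LeftModule N
  open AbelianGroup +ᴹ-abelianGroup using () renaming (_-_ to _-ᴹ_)
  open LeftModuleProperties N
  open import Algebra.Module.Properties.LeftModule N using (inverseˡ-uniqueᴹ)
  open AbelianGroupProperties +ᴹ-abelianGroup using ([x+y]-[u+v]≈[x-u]+[y-v])

  -- The determinant with rows rs, first column v (with entries in N) and remaining columns cs.
  mutual
    detᴺ : List I → (I → Carrierᴹ) → List I → Carrierᴹ
    detᴺ []       v cs = 0ᴹ
    detᴺ (r ∷ rs) v cs = det rs cs *ₗ v r -ᴹ expandᴺ r rs v [] cs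

    expandᴺ : I → List I → (I → Carrierᴹ) → List I → List I → Carrierᴹ
    expandᴺ r rs v pre []       = 0ᴹ
    expandᴺ r rs v pre (c ∷ cs) = A r c *ₗ detᴺ rs v (pre ++ cs) -ᴹ expandᴺ r rs v (pre ++ [ c ]) cs

  detᴺ-col : ∀ rs c x cs → detᴺ rs (λ r → A r c *ₗ x) cs ≈ᴹ det rs (c ∷ cs) *ₗ x
  detᴺ-col []       c x cs = ≈ᴹ-sym (*ₗ-zeroˡ x)
  detᴺ-col (r ∷ rs) c x cs = begin
    det rs cs *ₗ (A r c *ₗ x) -ᴹ expandᴺ r rs v [] cs
      ≈⟨ +ᴹ-cong (≈ᴹ-trans (≈ᴹ-sym (*ₗ-assoc _ _ x)) (*ₗ-congʳ (*-comm _ _))) (-ᴹ‿cong (expandᴺ-col [] cs)) ⟩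
    (A r c * det rs cs) *ₗ x -ᴹ expand r rs [ c ] cs *ₗ x
      ≈⟨ [a-b]*ₗx≈a*ₗx-b*ₗx _ _ x ⟨
    (A r c * det rs cs - expand r rs [ c ] cs) *ₗ x ∎
    where
    open SetoidReasoning ≈ᴹ-setoid
    v = λ r → A r c *ₗ x
    expandᴺ-col : ∀ pre cs → expandᴺ r rs v pre cs ≈ᴹ expand r rs (c ∷ pre) cs *ₗ x
    expandᴺ-col pre []        = ≈ᴹ-sym (*ₗ-zeroˡ x)
    expandᴺ-col pre (c′ ∷ cs) = begin
      A r c′ *ₗ detᴺ rs v (pre ++ cs) -ᴹ expandᴺ r rs v (pre ++ [ c′ ]) cs
        ≈⟨ +ᴹ-cong (*ₗ-congˡ (detᴺ-col rs c x (pre ++ cs))) (-ᴹ‿cong (expandᴺ-col (pre ++ [ c′ ]) cs)) ⟩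
      A r c′ *ₗ (det rs (c ∷ pre ++ cs) *ₗ x) -ᴹ expand r rs (c ∷ pre ++ [ c′ ]) cs *ₗ x
        ≈⟨ +ᴹ-congʳ (*ₗ-assoc _ _ x) ⟨
      (A r c′ * det rs (c ∷ pre ++ cs)) *ₗ x -ᴹ expand r rs (c ∷ pre ++ [ c′ ]) cs *ₗ x
        ≈⟨ [a-b]*ₗx≈a*ₗx-b*ₗx _ _ x ⟨
      (A r c′ * det rs (c ∷ pre ++ cs) - expand r rs (c ∷ pre ++ [ c′ ]) cs) *ₗ x ∎

  detᴺ-0ᴹ : ∀ rs cs → detᴺ rs (λ _ → 0ᴹ) cs ≈ᴹ 0ᴹ
  detᴺ-0ᴹ []       cs = ≈ᴹ-refl
  detᴺ-0ᴹ (r ∷ rs) cs = ≈ᴹ-trans (+ᴹ-cong (*ₗ-zeroʳ _) (-ᴹ‿cong (expandᴺ-0ᴹ [] cs))) (-ᴹ‿inverseʳ 0ᴹ)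
    where
    expandᴺ-0ᴹ : ∀ pre cs → expandᴺ r rs (λ _ → 0ᴹ) pre cs ≈ᴹ 0ᴹ
    expandᴺ-0ᴹ pre []       = ≈ᴹ-refl
    expandᴺ-0ᴹ pre (c ∷ cs) = ≈ᴹ-trans
      (+ᴹ-cong (≈ᴹ-trans (*ₗ-congˡ (detᴺ-0ᴹ rs (pre ++ cs))) (*ₗ-zeroʳ _)) (-ᴹ‿cong (expandᴺ-0ᴹ (pre ++ [ c ]) cs)))
      (-ᴹ‿inverseʳ 0ᴹ)

  detᴺ-+ᴹ : ∀ rs v w cs → detᴺ rs (λ r → v r +ᴹ w r) cs ≈ᴹ detᴺ rs v cs +ᴹ detᴺ rs w cs
  detᴺ-+ᴹ []       v w cs = ≈ᴹ-sym (+ᴹ-identityʳ 0ᴹ)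
  detᴺ-+ᴹ (r ∷ rs) v w cs = ≈ᴹ-trans
    (+ᴹ-cong (*ₗ-distribˡ _ _ _) (-ᴹ‿cong (expandᴺ-+ᴹ [] cs)))
    ([x+y]-[u+v]≈[x-u]+[y-v] _ _ _ _)
    where
    expandᴺ-+ᴹ : ∀ pre cs → expandᴺ r rs (λ r → v r +ᴹ w r) pre cs ≈ᴹ expandᴺ r rs v pre cs +ᴹ expandᴺ r rs w pre cs
    expandᴺ-+ᴹ pre []       = ≈ᴹ-sym (+ᴹ-identityʳ 0ᴹ)
    expandᴺ-+ᴹ pre (c ∷ cs) = ≈ᴹ-trans
      (+ᴹ-cong (≈ᴹ-trans (*ₗ-congˡ (detᴺ-+ᴹ rs v w (pre ++ cs))) (*ₗ-distribˡ _ _ _))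
               (-ᴹ‿cong (expandᴺ-+ᴹ (pre ++ [ c ]) cs)))
      ([x+y]-[u+v]≈[x-u]+[y-v] _ _ _ _)

  detᴺ-cong : ∀ rs {v w} cs → (∀ r → r ∈ rs → v r ≈ᴹ w r) → detᴺ rs v cs ≈ᴹ detᴺ rs w cs
  detᴺ-cong []       cs v≈w = ≈ᴹ-refl
  detᴺ-cong (r ∷ rs) {v} {w} cs v≈w = +ᴹ-cong (*ₗ-congˡ (v≈w r (here ≡.refl))) (-ᴹ‿cong (expandᴺ-cong [] cs))
    where
    expandᴺ-cong : ∀ pre cs → expandᴺ r rs v pre cs ≈ᴹ expandᴺ r rs w pre cs
    expandᴺ-cong pre []       = ≈ᴹ-refl
    expandᴺ-cong pre (c ∷ cs) =
      +ᴹ-cong (*ₗ-congˡ (detᴺ-cong rs (pre ++ cs) (λ r′ r′∈rs → v≈w r′ (there r′∈rs))))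
              (-ᴹ‿cong (expandᴺ-cong (pre ++ [ c ]) cs))

  detᴺ-∑ : ∀ rs cs ds (x : I → Carrierᴹ) →
           detᴺ rs (λ r → ∑[ c ∈ ds ] A r c *ₗ x c) cs ≈ᴹ ∑[ c ∈ ds ] det rs (c ∷ cs) *ₗ x c
  detᴺ-∑ rs cs []       x = detᴺ-0ᴹ rs cs
  detᴺ-∑ rs cs (d ∷ ds) x = ≈ᴹ-trans (detᴺ-+ᴹ rs _ _ cs) (+ᴹ-cong (detᴺ-col rs d (x d) cs) (detᴺ-∑ rs cs ds x))

  -- Cramer's rule adj(A) · A = det(A) · 1, applied to a vector w in the kernel of A.
  det-annihilates-kernel : ∀ rs c₀ cs (w : I → Carrierᴹ) →
    (∀ r → r ∈ rs → ∑[ c ∈ c₀ ∷ cs ] A r c *ₗ w c ≈ᴹ 0ᴹ) → det rs (c₀ ∷ cs) *ₗ w c₀ ≈ᴹ 0ᴹ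
  det-annihilates-kernel rs c₀ cs w Aw≈0 = begin
    det rs (c₀ ∷ cs) *ₗ w c₀                         ≈⟨ detᴺ-col rs c₀ (w c₀) cs ⟨
    detᴺ rs (λ r → A r c₀ *ₗ w c₀) cs                ≈⟨ detᴺ-cong rs cs first-col ⟩
    detᴺ rs (λ r → ∑[ c ∈ cs ] A r c *ₗ -ᴹ w c) cs   ≈⟨ detᴺ-∑ rs cs cs (λ c → -ᴹ w c) ⟩
    ∑[ c ∈ cs ] det rs (c ∷ cs) *ₗ -ᴹ w c             ≈⟨ ∑-zero cs repeated-col ⟩
    0ᴹ                                               ∎
    where
    open SetoidReasoning ≈ᴹ-setoid
    repeated-col : ∀ c → c ∈ cs → det rs (c ∷ cs) *ₗ -ᴹ w c ≈ᴹ 0ᴹ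
    repeated-col c c∈cs = ≈ᴹ-trans (*ₗ-congʳ (det-∈-col rs c∈cs)) (*ₗ-zeroˡ _)
    first-col : ∀ r → r ∈ rs → A r c₀ *ₗ w c₀ ≈ᴹ ∑[ c ∈ cs ] A r c *ₗ -ᴹ w c
    first-col r r∈rs = begin
      A r c₀ *ₗ w c₀                   ≈⟨ inverseˡ-uniqueᴹ _ _ (Aw≈0 r r∈rs) ⟩
      -ᴹ (∑[ c ∈ cs ] A r c *ₗ w c)    ≈⟨ -ᴹ‿distrib-∑ cs _ ⟩
      ∑[ c ∈ cs ] -ᴹ (A r c *ₗ w c)    ≈⟨ ∑-cong cs (λ c _ → -ᴹ‿distribʳ-*ₗ (A r c) (w c)) ⟨
      ∑[ c ∈ cs ] A r c *ₗ -ᴹ w c      ∎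

module ShiftOperators {r ℓr m ℓm} {R : CommutativeRing r ℓr} (M : Module R m ℓm) where
  open CommutativeRing R using (_+_; _*_; -_; 0#; 1#; *-comm) renaming (Carrier to K)
  open Module M
  open LeftModuleProperties leftModule
  open import Algebra.Properties.AbelianGroup +ᴹ-abelianGroup using (ε⁻¹≈ε; ⁻¹-∙-comm)
  open import Algebra.Properties.CommutativeSemigroup (AbelianGroup.commutativeSemigroup +ᴹ-abelianGroup)
    using (interchange)
  open SetoidReasoning ≈ᴹ-setoid

  Seq : Set m
  Seq = ℕ → Carrierᴹ

  -- A coefficient list p₀ ∷ p₁ ∷ … ∷ pₙ stands for the operator p₀ + p₁ E + ⋯ + pₙ Eⁿ on sequences,
  -- where E is the shift (E s) i = s (1 + i).
  Op : Set r
  Op = List K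

  act : Op → Seq → Seq
  act []      s i = 0ᴹ
  act (a ∷ p) s i = a *ₗ s i +ᴹ act p s (suc i)

  infixl 6 _+ₒ_
  infixl 7 _*ₒ_ _·ₒ_
  infix  8 -ₒ_

  _+ₒ_ : Op → Op → Op
  []      +ₒ q       = q
  (a ∷ p) +ₒ []      = a ∷ p
  (a ∷ p) +ₒ (b ∷ q) = a + b ∷ p +ₒ q

  -ₒ_ : Op → Op
  -ₒ []      = []
  -ₒ (a ∷ p) = - a ∷ -ₒ p

  _·ₒ_ : K → Op → Op
  a ·ₒ []      = []
  a ·ₒ (b ∷ p) = a * b ∷ a ·ₒ p

  _*ₒ_ : Op → Op → Op
  []      *ₒ q = []
  (a ∷ p) *ₒ q = a ·ₒ q +ₒ (0# ∷ p *ₒ q)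

  1ₒ : Op
  1ₒ = [ 1# ]

  act-+ₒ : ∀ p q s i → act (p +ₒ q) s i ≈ᴹ act p s i +ᴹ act q s i
  act-+ₒ []      q       s i = ≈ᴹ-sym (+ᴹ-identityˡ _)
  act-+ₒ (a ∷ p) []      s i = ≈ᴹ-sym (+ᴹ-identityʳ _)
  act-+ₒ (a ∷ p) (b ∷ q) s i =
    ≈ᴹ-trans (+ᴹ-cong (*ₗ-distribʳ (s i) a b) (act-+ₒ p q s (suc i))) (interchange _ _ _ _)

  act--ₒ : ∀ p s i → act (-ₒ p) s i ≈ᴹ -ᴹ act p s i
  act--ₒ []      s i = ≈ᴹ-sym ε⁻¹≈ε
  act--ₒ (a ∷ p) s i = ≈ᴹ-trans (+ᴹ-cong (-‿distribˡ-*ₗ a (s i)) (act--ₒ p s (suc i))) (⁻¹-∙-comm _ _)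

  act-·ₒ : ∀ a p s i → act (a ·ₒ p) s i ≈ᴹ a *ₗ act p s i
  act-·ₒ a []      s i = ≈ᴹ-sym (*ₗ-zeroʳ a)
  act-·ₒ a (b ∷ p) s i =
    ≈ᴹ-trans (+ᴹ-cong (*ₗ-assoc a b (s i)) (act-·ₒ a p s (suc i))) (≈ᴹ-sym (*ₗ-distribˡ a _ _))

  act-0∷ : ∀ p s i → act (0# ∷ p) s i ≈ᴹ act p s (suc i)
  act-0∷ p s i = ≈ᴹ-trans (+ᴹ-congʳ (*ₗ-zeroˡ (s i))) (+ᴹ-identityˡ _)

  act-*ₒ : ∀ p q s i → act (p *ₒ q) s i ≈ᴹ act p (act q s) i
  act-*ₒ []      q s i = ≈ᴹ-refl
  act-*ₒ (a ∷ p) q s i = begin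
    act (a ·ₒ q +ₒ (0# ∷ p *ₒ q)) s i             ≈⟨ act-+ₒ (a ·ₒ q) _ s i ⟩
    act (a ·ₒ q) s i +ᴹ act (0# ∷ p *ₒ q) s i     ≈⟨ +ᴹ-cong (act-·ₒ a q s i) (act-0∷ (p *ₒ q) s i) ⟩
    a *ₗ act q s i +ᴹ act (p *ₒ q) s (suc i)      ≈⟨ +ᴹ-congˡ (act-*ₒ p q s (suc i)) ⟩
    a *ₗ act q s i +ᴹ act p (act q s) (suc i)     ∎

  act-1ₒ : ∀ s i → act 1ₒ s i ≈ᴹ s i
  act-1ₒ s i = ≈ᴹ-trans (+ᴹ-identityʳ _) (*ₗ-identityˡ _)

  act-cong : ∀ p {s s′} → (∀ j → s j ≈ᴹ s′ j) → ∀ i → act p s i ≈ᴹ act p s′ i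
  act-cong []      s≈s′ i = ≈ᴹ-refl
  act-cong (a ∷ p) s≈s′ i = +ᴹ-cong (*ₗ-congˡ (s≈s′ i)) (act-cong p s≈s′ (suc i))

  act-+ᴹ : ∀ p s s′ i → act p (λ j → s j +ᴹ s′ j) i ≈ᴹ act p s i +ᴹ act p s′ i
  act-+ᴹ []      s s′ i = ≈ᴹ-sym (+ᴹ-identityʳ _)
  act-+ᴹ (a ∷ p) s s′ i =
    ≈ᴹ-trans (+ᴹ-cong (*ₗ-distribˡ a _ _) (act-+ᴹ p s s′ (suc i))) (interchange _ _ _ _)

  act-0ᴹ : ∀ p i → act p (λ _ → 0ᴹ) i ≈ᴹ 0ᴹ
  act-0ᴹ []      i = ≈ᴹ-refl
  act-0ᴹ (a ∷ p) i = ≈ᴹ-trans (+ᴹ-cong (*ₗ-zeroʳ a) (act-0ᴹ p (suc i))) (+ᴹ-identityʳ _)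

  act-*ₗ : ∀ p a s i → act p (λ j → a *ₗ s j) i ≈ᴹ a *ₗ act p s i
  act-*ₗ []      a s i = ≈ᴹ-sym (*ₗ-zeroʳ a)
  act-*ₗ (b ∷ p) a s i = begin
    b *ₗ (a *ₗ s i) +ᴹ act p (λ j → a *ₗ s j) (suc i) ≈⟨ +ᴹ-cong b*ₗa*ₗ≈a*ₗb*ₗ (act-*ₗ p a s (suc i)) ⟩
    a *ₗ (b *ₗ s i) +ᴹ a *ₗ act p s (suc i)           ≈⟨ *ₗ-distribˡ a _ _ ⟨
    a *ₗ (b *ₗ s i +ᴹ act p s (suc i))                ∎
    where
    b*ₗa*ₗ≈a*ₗb*ₗ : b *ₗ (a *ₗ s i) ≈ᴹ a *ₗ (b *ₗ s i)
    b*ₗa*ₗ≈a*ₗb*ₗ = ≈ᴹ-trans (≈ᴹ-sym (*ₗ-assoc b a (s i))) (≈ᴹ-trans (*ₗ-congʳ (*-comm b a)) (*ₗ-assoc a b (s i)))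

  act-suc : ∀ p s i → act p (λ j → s (suc j)) i ≈ᴹ act p s (suc i)
  act-suc []      s i = ≈ᴹ-refl
  act-suc (a ∷ p) s i = +ᴹ-congˡ (act-suc p s (suc i))

  -- The shift commutes with scalars because R is commutative; this makes the operators commute.
  act-comm : ∀ p q s i → act p (act q s) i ≈ᴹ act q (act p s) i
  act-comm []      q s i = ≈ᴹ-sym (act-0ᴹ q i)
  act-comm (a ∷ p) q s i = begin
    a *ₗ act q s i +ᴹ act p (act q s) (suc i)                 ≈⟨ +ᴹ-congˡ (act-comm p q s (suc i)) ⟩
    a *ₗ act q s i +ᴹ act q (act p s) (suc i)                 ≈⟨ +ᴹ-cong (act-*ₗ q a s i) (act-suc q (act p s) i) ⟨
    act q (λ j → a *ₗ s j) i +ᴹ act q (λ j → act p s (suc j)) i ≈⟨ act-+ᴹ q _ _ i ⟨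
    act q (λ j → a *ₗ s j +ᴹ act p s (suc j)) i               ∎

  -- Operators are identified when they act alike on every sequence; the ring laws then follow from those of M.
  infix 4 _≋_
  record _≋_ (p q : Op) : Set (m ⊔ ℓm) where
    constructor mk≋
    field act-≈ : ∀ s i → act p s i ≈ᴹ act q s i
  open _≋_ public

  ≋-isEquivalence : IsEquivalence _≋_
  ≋-isEquivalence = record
    { refl  = mk≋ λ s i → ≈ᴹ-refl
    ; sym   = λ p≋q → mk≋ λ s i → ≈ᴹ-sym (act-≈ p≋q s i)
    ; trans = λ p≋q q≋o → mk≋ λ s i → ≈ᴹ-trans (act-≈ p≋q s i) (act-≈ q≋o s i)
    }

  operatorRing : CommutativeRing r (m ⊔ ℓm)
  operatorRing = record
    { Carrier = Op ; _≈_ = _≋_ ; _+_ = _+ₒ_ ; _*_ = _*ₒ_ ; -_ = -ₒ_ ; 0# = [] ; 1# = 1ₒ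
    ; isCommutativeRing = record
      { isRing = record
        { +-isAbelianGroup = record
          { isGroup = record
            { isMonoid = record
              { isSemigroup = record
                { isMagma = record
                  { isEquivalence = ≋-isEquivalence
                  ; ∙-cong = λ {p} {p′} {q} {q′} p≋p′ q≋q′ → mk≋ λ s i → begin
                      act (p +ₒ q) s i         ≈⟨ act-+ₒ p q s i ⟩
                      act p s i +ᴹ act q s i   ≈⟨ +ᴹ-cong (act-≈ p≋p′ s i) (act-≈ q≋q′ s i) ⟩
                      act p′ s i +ᴹ act q′ s i ≈⟨ act-+ₒ p′ q′ s i ⟨
                      act (p′ +ₒ q′) s i       ∎
                  }
                ; assoc = λ p q o → mk≋ λ s i → begin
                    act (p +ₒ q +ₒ o) s i                 ≈⟨ act-+ₒ (p +ₒ q) o s i ⟩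
                    act (p +ₒ q) s i +ᴹ act o s i         ≈⟨ +ᴹ-congʳ (act-+ₒ p q s i) ⟩
                    act p s i +ᴹ act q s i +ᴹ act o s i   ≈⟨ +ᴹ-assoc _ _ _ ⟩
                    act p s i +ᴹ (act q s i +ᴹ act o s i) ≈⟨ +ᴹ-congˡ (act-+ₒ q o s i) ⟨
                    act p s i +ᴹ act (q +ₒ o) s i         ≈⟨ act-+ₒ p (q +ₒ o) s i ⟨
                    act (p +ₒ (q +ₒ o)) s i               ∎
                }
              ; identity = (λ p → mk≋ λ s i → ≈ᴹ-refl)
                         , (λ p → mk≋ λ s i → ≈ᴹ-trans (act-+ₒ p [] s i) (+ᴹ-identityʳ _))
              }
            ; inverse = (λ p → mk≋ λ s i →
                          ≈ᴹ-trans (act-+ₒ (-ₒ p) p s i) (≈ᴹ-trans (+ᴹ-congʳ (act--ₒ p s i)) (-ᴹ‿inverseˡ _)))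
                      , (λ p → mk≋ λ s i →
                          ≈ᴹ-trans (act-+ₒ p (-ₒ p) s i) (≈ᴹ-trans (+ᴹ-congˡ (act--ₒ p s i)) (-ᴹ‿inverseʳ _)))
            ; ⁻¹-cong = λ {p} {q} p≋q → mk≋ λ s i →
                ≈ᴹ-trans (act--ₒ p s i) (≈ᴹ-trans (-ᴹ‿cong (act-≈ p≋q s i)) (≈ᴹ-sym (act--ₒ q s i)))
            }
          ; comm = λ p q → mk≋ λ s i →
              ≈ᴹ-trans (act-+ₒ p q s i) (≈ᴹ-trans (+ᴹ-comm _ _) (≈ᴹ-sym (act-+ₒ q p s i)))
          }
        ; *-cong = λ {p} {p′} {q} {q′} p≋p′ q≋q′ → mk≋ λ s i → begin
            act (p *ₒ q) s i      ≈⟨ act-*ₒ p q s i ⟩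
            act p (act q s) i     ≈⟨ act-≈ p≋p′ (act q s) i ⟩
            act p′ (act q s) i    ≈⟨ act-cong p′ (act-≈ q≋q′ s) i ⟩
            act p′ (act q′ s) i   ≈⟨ act-*ₒ p′ q′ s i ⟨
            act (p′ *ₒ q′) s i    ∎
        ; *-assoc = λ p q o → mk≋ λ s i → begin
            act (p *ₒ q *ₒ o) s i        ≈⟨ act-*ₒ (p *ₒ q) o s i ⟩
            act (p *ₒ q) (act o s) i     ≈⟨ act-*ₒ p q (act o s) i ⟩
            act p (act q (act o s)) i    ≈⟨ act-cong p (act-*ₒ q o s) i ⟨
            act p (act (q *ₒ o) s) i     ≈⟨ act-*ₒ p (q *ₒ o) s i ⟨
            act (p *ₒ (q *ₒ o)) s i      ∎
        ; *-identity = (λ p → mk≋ λ s i → ≈ᴹ-trans (act-*ₒ 1ₒ p s i) (act-1ₒ (act p s) i))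
                     , (λ p → mk≋ λ s i → ≈ᴹ-trans (act-*ₒ p 1ₒ s i) (act-cong p (act-1ₒ s) i))
        ; distrib = (λ p q o → mk≋ λ s i → begin
                      act (p *ₒ (q +ₒ o)) s i                    ≈⟨ act-*ₒ p (q +ₒ o) s i ⟩
                      act p (act (q +ₒ o) s) i                   ≈⟨ act-cong p (act-+ₒ q o s) i ⟩
                      act p (λ j → act q s j +ᴹ act o s j) i     ≈⟨ act-+ᴹ p (act q s) (act o s) i ⟩
                      act p (act q s) i +ᴹ act p (act o s) i     ≈⟨ +ᴹ-cong (act-*ₒ p q s i) (act-*ₒ p o s i) ⟨
                      act (p *ₒ q) s i +ᴹ act (p *ₒ o) s i       ≈⟨ act-+ₒ (p *ₒ q) (p *ₒ o) s i ⟨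
                      act (p *ₒ q +ₒ p *ₒ o) s i                 ∎)
                  , (λ p q o → mk≋ λ s i → begin
                      act ((q +ₒ o) *ₒ p) s i                    ≈⟨ act-*ₒ (q +ₒ o) p s i ⟩
                      act (q +ₒ o) (act p s) i                   ≈⟨ act-+ₒ q o (act p s) i ⟩
                      act q (act p s) i +ᴹ act o (act p s) i     ≈⟨ +ᴹ-cong (act-*ₒ q p s i) (act-*ₒ o p s i) ⟨
                      act (q *ₒ p) s i +ᴹ act (o *ₒ p) s i       ≈⟨ act-+ₒ (q *ₒ p) (o *ₒ p) s i ⟨
                      act (q *ₒ p +ₒ o *ₒ p) s i                 ∎)
        }
      ; *-comm = λ p q → mk≋ λ s i → begin
          act (p *ₒ q) s i     ≈⟨ act-*ₒ p q s i ⟩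
          act p (act q s) i    ≈⟨ act-comm p q s i ⟩
          act q (act p s) i    ≈⟨ act-*ₒ q p s i ⟨
          act (q *ₒ p) s i     ∎
      }
    }

  sequenceModule : LeftModule (CommutativeRing.ring operatorRing) m ℓm
  sequenceModule = record
    { Carrierᴹ = Seq ; _≈ᴹ_ = λ s s′ → ∀ i → s i ≈ᴹ s′ i ; _+ᴹ_ = λ s s′ i → s i +ᴹ s′ i
    ; _*ₗ_ = act ; 0ᴹ = λ _ → 0ᴹ ; -ᴹ_ = λ s i → -ᴹ s i
    ; isLeftModule = record
      { isLeftSemimodule = record
        { +ᴹ-isCommutativeMonoid = IsAbelianGroup.isCommutativeMonoid (Pointwise.isAbelianGroup ℕ +ᴹ-isAbelianGroup)
        ; isPreleftSemimodule = record
          { *ₗ-cong = λ {p} {q} {s} {s′} p≋q s≈s′ i → ≈ᴹ-trans (act-≈ p≋q s i) (act-cong q s≈s′ i)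
          ; *ₗ-zeroˡ = λ s i → ≈ᴹ-refl
          ; *ₗ-distribʳ = λ s p q i → act-+ₒ p q s i
          ; *ₗ-identityˡ = λ s i → act-1ₒ s i
          ; *ₗ-assoc = λ p q s i → act-*ₒ p q s i
          ; *ₗ-zeroʳ = λ p i → act-0ᴹ p i
          ; *ₗ-distribˡ = λ p s s′ i → act-+ᴹ p s s′ i
          }
        }
      ; -ᴹ‿cong = λ s≈s′ i → -ᴹ‿cong (s≈s′ i)
      ; -ᴹ‿inverse = (λ s i → -ᴹ‿inverseˡ (s i)) , (λ s i → -ᴹ‿inverseʳ (s i))
      }
    }

module OperatorDegrees {r ℓr m ℓm} {R : CommutativeRing r ℓr} (M : Module R m ℓm) where
  open import Data.Nat using (_+_; _∸_; _≤_; _<_; _<?_; z≤n; s≤s)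
  open import Data.Nat.Properties
    using ( ≤-trans; ≤-reflexive; ≤-refl; m≤n+m; +-monoˡ-≤; +-monoʳ-<; <-≤-trans; n≤1+n
          ; +-comm; +-suc; +-identityʳ; m∸n+n≡m; ≮⇒≥)
  open import Data.Nat.Induction using (<-rec)
  open import Relation.Nullary using (yes; no)
  open import Data.List using (length)
  open CommutativeRing R using (0#)
  open Module M
  open import Algebra.Module.Properties.LeftModule leftModule using (inverseʳ-uniqueᴹ)
  open import Algebra.Properties.AbelianGroup +ᴹ-abelianGroup using (ε⁻¹≈ε)
  open ShiftOperators M
  private module O = CommutativeRing operatorRing

  length-+ₒ : ∀ p q {n} → length p ≤ n → length q ≤ n → length (p +ₒ q) ≤ n
  length-+ₒ []      q       p≤n q≤n = q≤n
  length-+ₒ (a ∷ p) []      p≤n q≤n = p≤n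
  length-+ₒ (a ∷ p) (b ∷ q) (s≤s p≤n) (s≤s q≤n) = s≤s (length-+ₒ p q p≤n q≤n)

  length--ₒ : ∀ p → length (-ₒ p) ≡ length p
  length--ₒ []      = ≡.refl
  length--ₒ (a ∷ p) = ≡.cong suc (length--ₒ p)

  length-·ₒ : ∀ a p → length (a ·ₒ p) ≡ length p
  length-·ₒ a []      = ≡.refl
  length-·ₒ a (b ∷ p) = ≡.cong suc (length-·ₒ a p)

  length-*ₒ : ∀ p q {n} → length q ≤ suc n → length (p *ₒ q) ≤ length p + n
  length-*ₒ []      q q≤1+n = z≤n
  length-*ₒ (a ∷ p) q {n} q≤1+n = length-+ₒ (a ·ₒ q) (0# ∷ p *ₒ q)
    (≤-trans (≤-reflexive (length-·ₒ a q)) (≤-trans q≤1+n (s≤s (m≤n+m n (length p)))))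
    (s≤s (length-*ₒ p q q≤1+n))

  Degree< : ℕ → Op → Set (r ⊔ m ⊔ ℓm)
  Degree< n p = Σ Op λ c → length c ≤ n × p ≋ c

  Degree<-+ₒ : ∀ {n p q} → Degree< n p → Degree< n q → Degree< n (p +ₒ q)
  Degree<-+ₒ (c , c≤n , p≋c) (c′ , c′≤n , q≋c′) = c +ₒ c′ , length-+ₒ c c′ c≤n c′≤n , O.+-cong p≋c q≋c′

  Degree<--ₒ : ∀ {n p} → Degree< n p → Degree< n (-ₒ p)
  Degree<--ₒ (c , c≤n , p≋c) = -ₒ c , ≤-trans (≤-reflexive (length--ₒ c)) c≤n , O.-‿cong p≋c

  Degree<-*ₒ : ∀ {a b p q} → Degree< a p → Degree< (suc b) q → Degree< (a + b) (p *ₒ q)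
  Degree<-*ₒ {b = b} (c , c≤a , p≋c) (c′ , c′≤1+b , q≋c′) =
    c *ₒ c′ , ≤-trans (length-*ₒ c c′ c′≤1+b) (+-monoˡ-≤ b c≤a) , O.*-cong p≋c q≋c′

  Degree<-mono : ∀ {n n′ p} → n ≤ n′ → Degree< n p → Degree< n′ p
  Degree<-mono n≤n′ (c , c≤n , p≋c) = c , ≤-trans c≤n n≤n′ , p≋c

  Degree<-length : ∀ p → Degree< (length p) p
  Degree<-length p = p , ≤-refl , O.refl

  Degree<-0ₒ : ∀ {n} → Degree< n []
  Degree<-0ₒ = [] , z≤n , O.refl

  X^ : ℕ → Op
  X^ zero    = 1ₒ
  X^ (suc n) = 0# ∷ X^ n

  X : Op
  X = X^ 1

  length-X^ : ∀ n → length (X^ n) ≡ suc n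
  length-X^ zero    = ≡.refl
  length-X^ (suc n) = ≡.cong suc (length-X^ n)

  act-X^ : ∀ n s i → act (X^ n) s i ≈ᴹ s (i + n)
  act-X^ zero    s i = ≈ᴹ-trans (act-1ₒ s i) (≈ᴹ-reflexive (≡.cong s (≡.sym (+-identityʳ i))))
  act-X^ (suc n) s i = ≈ᴹ-trans (act-0∷ (X^ n) s i)
    (≈ᴹ-trans (act-X^ n s (suc i)) (≈ᴹ-reflexive (≡.cong s (≡.sym (+-suc i n)))))

  X*ₒ : ∀ q → X *ₒ q ≋ 0# ∷ q
  X*ₒ q = mk≋ λ s i → begin
    act (X *ₒ q) s i       ≈⟨ act-*ₒ X q s i ⟩
    act X (act q s) i      ≈⟨ act-X^ 1 (act q s) i ⟩
    act q s (i + 1)        ≈⟨ ≈ᴹ-reflexive (≡.cong (act q s) (+-comm i 1)) ⟩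
    act q s (suc i)        ≈⟨ act-0∷ q s i ⟨
    act (0# ∷ q) s i       ∎
    where open SetoidReasoning ≈ᴹ-setoid

  Monic : ℕ → Op → Set (r ⊔ m ⊔ ℓm)
  Monic n p = Σ Op λ c → length c ≤ n × p ≋ c +ₒ X^ n

  Monic-≋ : ∀ {n p q} → p ≋ q → Monic n q → Monic n p
  Monic-≋ p≋q (c , c≤n , q≋c+Xⁿ) = c , c≤n , O.trans p≋q q≋c+Xⁿ

  Degree<⇒Monic-+ₒX^ : ∀ {n p} → Degree< n p → Monic n (p +ₒ X^ n)
  Degree<⇒Monic-+ₒX^ (c , c≤n , p≋c) = c , c≤n , O.+-congʳ p≋c

  Monic-*ₒ : ∀ {n p q} → Monic 1 p → Monic n q → Monic (suc n) (p *ₒ q)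
  Monic-*ₒ {n} {p} {q} (c , c≤1 , p≋c+X) (c′ , c′≤n , q≋c′+Xⁿ) = Monic-≋ p*q≋ (Degree<⇒Monic-+ₒX^ lower)
    where
    open SemiringProperties O.semiring
    lower : Degree< (suc n) (c *ₒ c′ +ₒ c *ₒ X^ n +ₒ X *ₒ c′)
    lower = Degree<-+ₒ
      (Degree<-+ₒ (Degree<-*ₒ (c , c≤1 , O.refl) (c′ , ≤-trans c′≤n (n≤1+n n) , O.refl))
                  (Degree<-*ₒ (c , c≤1 , O.refl) (X^ n , ≤-reflexive (length-X^ n) , O.refl)))
      (0# ∷ c′ , s≤s c′≤n , X*ₒ c′)
    p*q≋ : p *ₒ q ≋ c *ₒ c′ +ₒ c *ₒ X^ n +ₒ X *ₒ c′ +ₒ X^ (suc n)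
    p*q≋ = O.trans (O.*-cong p≋c+X q≋c′+Xⁿ)
             (O.trans ([a+b][x+y]≈ax+ay+bx+by c X c′ (X^ n)) (O.+-congˡ (X*ₒ (X^ n))))

  Monic--ₒ : ∀ {n p q} → Monic n p → Degree< n q → Monic n (p +ₒ -ₒ q)
  Monic--ₒ {n} (c , c≤n , p≋c+Xⁿ) (c′ , c′≤n , q≋c′) =
    Monic-≋ (O.trans (O.+-cong p≋c+Xⁿ (O.-‿cong q≋c′)) ([x+y]-z≈[x-z]+y c (X^ n) c′))
            (Degree<⇒Monic-+ₒX^ (Degree<-+ₒ (c , c≤n , O.refl) (Degree<--ₒ (c′ , c′≤n , O.refl))))
    where open AbelianGroupProperties O.+-abelianGroup using ([x+y]-z≈[x-z]+y)

  Monic-act : ∀ {n p} → Monic n p →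
              Σ Op λ c → length c ≤ n × (∀ s i → act p s i ≈ᴹ act c s i +ᴹ s (i + n))
  Monic-act {n} (c , c≤n , p≋c+Xⁿ) = c , c≤n , λ s i →
    ≈ᴹ-trans (act-≈ p≋c+Xⁿ s i) (≈ᴹ-trans (act-+ₒ c (X^ n) s i) (+ᴹ-congˡ (act-X^ n s i)))

  act-vanishing : ∀ c s j → (∀ l → l < length c → s (j + l) ≈ᴹ 0ᴹ) → act c s j ≈ᴹ 0ᴹ
  act-vanishing []      s j s≈0 = ≈ᴹ-refl
  act-vanishing (a ∷ c) s j s≈0 = ≈ᴹ-trans
    (+ᴹ-cong (≈ᴹ-trans (*ₗ-congˡ (≈ᴹ-trans (≈ᴹ-reflexive (≡.cong s (≡.sym (+-identityʳ j)))) (s≈0 0 (s≤s z≤n))))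
                       (*ₗ-zeroʳ a))
             (act-vanishing c s (suc j) λ l l<c →
               ≈ᴹ-trans (≈ᴹ-reflexive (≡.cong s (≡.sym (+-suc j l)))) (s≈0 (suc l) (s≤s l<c))))
    (+ᴹ-identityʳ 0ᴹ)

  Monic-annihilator-vanishes : ∀ {d p s} → Monic d p → (∀ j → act p s j ≈ᴹ 0ᴹ) →
                               (∀ i → i < d → s i ≈ᴹ 0ᴹ) → ∀ i → s i ≈ᴹ 0ᴹ
  Monic-annihilator-vanishes {d} {p} {s} monic ps≈0 s<d≈0 = <-rec (λ i → s i ≈ᴹ 0ᴹ) vanishes
    where
    open SetoidReasoning ≈ᴹ-setoid
    c = proj₁ (Monic-act monic)
    c≤d = proj₁ (proj₂ (Monic-act monic))
    p≈c+Xᵈ = proj₂ (proj₂ (Monic-act monic))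
    vanishes : ∀ i → (∀ {i′} → i′ < i → s i′ ≈ᴹ 0ᴹ) → s i ≈ᴹ 0ᴹ
    vanishes i below with i <? d
    ... | yes i<d = s<d≈0 i i<d
    ... | no  i≮d = begin
      s i               ≈⟨ ≈ᴹ-reflexive (≡.cong s (≡.sym i∸d+d≡i)) ⟩
      s (j + d)         ≈⟨ inverseʳ-uniqueᴹ _ _ (≈ᴹ-trans (≈ᴹ-sym (p≈c+Xᵈ s j)) (ps≈0 j)) ⟩
      -ᴹ act c s j      ≈⟨ -ᴹ‿cong (act-vanishing c s j λ l l<c → below (j+l<i l l<c)) ⟩
      -ᴹ 0ᴹ             ≈⟨ ε⁻¹≈ε ⟩
      0ᴹ                ∎
      where
      j = i ∸ d
      i∸d+d≡i : j + d ≡ i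
      i∸d+d≡i = m∸n+n≡m (≮⇒≥ i≮d)
      j+l<i : ∀ l → l < length c → j + l < i
      j+l<i l l<c = ≡.subst (j + l <_) i∸d+d≡i (+-monoʳ-< j (<-≤-trans l<c c≤d))

module OperatorDeterminantDegree {r ℓr m ℓm} {R : CommutativeRing r ℓr} (M : Module R m ℓm)
                                 {i} {I : Set i} (A : I → I → ShiftOperators.Op M) where
  open import Data.Nat using (_+_)
  open ShiftOperators M
  open OperatorDegrees M
  open Determinant operatorRing A

  expand-degree : ∀ {a} r rs pre cs → (∀ cs′ → Degree< (suc (length rs)) (det rs cs′)) →
                  (∀ c → c ∈ cs → Degree< a (A r c)) → Degree< (a + length rs) (expand r rs pre cs)
  expand-degree r rs pre []       det< A< = Degree<-0ₒ
  expand-degree r rs pre (c ∷ cs) det< A< = Degree<-+ₒ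
    (Degree<-*ₒ (A< c (here ≡.refl)) (det< (pre ++ cs)))
    (Degree<--ₒ (expand-degree r rs (pre ++ [ c ]) cs det< (λ c′ c′∈cs → A< c′ (there c′∈cs))))

  det-degree : (∀ r c → Degree< 2 (A r c)) → ∀ rs cs → Degree< (suc (length rs)) (det rs cs)
  det-degree A< []       []      = Degree<-length 1ₒ
  det-degree A< []       (_ ∷ _) = Degree<-0ₒ
  det-degree A< (r ∷ rs) cs      = expand-degree r rs [] cs (det-degree A< rs) (λ c _ → A< r c)

module _ where
  open import Data.Nat using (_+_; _≤_; _<_; s≤s)
  open import Data.Nat.Properties using (≤-refl; <⇒≤; +-suc; m≤m+n)

  range : ℕ → ℕ → List ℕ
  range k zero    = []
  range k (suc n) = k ∷ range (suc k) n

  length-range : ∀ k n → length (range k n) ≡ n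
  length-range k zero    = ≡.refl
  length-range k (suc n) = ≡.cong suc (length-range (suc k) n)

  ∈-range⁻ : ∀ {x} k n → x ∈ range k n → k ≤ x × x < k + n
  ∈-range⁻ k (suc n) (here ≡.refl) = ≤-refl , ≡.subst (k <_) (≡.sym (+-suc k n)) (s≤s (m≤m+n k n))
  ∈-range⁻ {x} k (suc n) (there x∈) with k<x , x<k+1+n ← ∈-range⁻ (suc k) n x∈ =
    <⇒≤ k<x , ≡.subst (x <_) (≡.sym (+-suc k n)) x<k+1+n

module KroneckerDelta {r ℓr m ℓm} {R : CommutativeRing r ℓr} (M : Module R m ℓm) where
  open import Data.Nat using (_+_; _≤_; _<_; _≟_)
  open import Data.Nat.Properties using (<⇒≢; >⇒≢; ≤⇒≯; m≤n⇒m<n∨m≡n; +-suc; +-identityʳ)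
  open import Data.Sum using (inj₁; inj₂)
  open import Data.Bool using (if_then_else_)
  open import Relation.Nullary using (does; contradiction)
  open import Relation.Nullary.Decidable using (dec-true; dec-false)
  open CommutativeRing R using (0#; 1#) renaming (Carrier to K)
  open Module M
  open LeftModuleProperties leftModule

  δ : ℕ → ℕ → K
  δ r c = if does (r ≟ c) then 1# else 0#

  δ-diag : ∀ r x → δ r r *ₗ x ≈ᴹ x
  δ-diag r x rewrite dec-true (r ≟ r) ≡.refl = *ₗ-identityˡ x

  δ-off : ∀ {r c} → r ≢ c → ∀ x → δ r c *ₗ x ≈ᴹ 0ᴹ
  δ-off {r} {c} r≢c x rewrite dec-false (r ≟ c) r≢c = *ₗ-zeroˡ x

  ∑-δ : ∀ {N} k n (x : ℕ → Carrierᴹ) → k ≤ N → N < k + n → ∑[ j ∈ range k n ] δ N j *ₗ x j ≈ᴹ x N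
  ∑-δ {N} k zero    x k≤N N<k+0 = contradiction (≡.subst (N <_) (+-identityʳ k) N<k+0) (≤⇒≯ k≤N)
  ∑-δ {N} k (suc n) x k≤N N<k+1+n with m≤n⇒m<n∨m≡n k≤N
  ... | inj₂ ≡.refl = ≈ᴹ-trans (+ᴹ-cong (δ-diag k (x k)) (∑-zero (range (suc k) n) λ j j∈ →
                        δ-off (<⇒≢ (proj₁ (∈-range⁻ (suc k) n j∈))) (x j)))
                      (+ᴹ-identityʳ (x k))
  ... | inj₁ k<N    = ≈ᴹ-trans (+ᴹ-cong (δ-off (>⇒≢ k<N) (x k))
                                        (∑-δ (suc k) n x k<N (≡.subst (N <_) (+-suc k n) N<k+1+n)))
                      (+ᴹ-identityˡ (x N))

module CharacteristicMatrix {r ℓr m ℓm} {R : CommutativeRing r ℓr} (M : Module R m ℓm)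
                            (Y : ℕ → ℕ → CommutativeRing.Carrier R) where
  open import Data.Nat using (z≤n; s≤s)
  open import Data.Nat.Properties using (≤-reflexive; <⇒≢)
  open CommutativeRing R using (-_; +-identityʳ)
  open Module M
  open LeftModuleProperties leftModule
  open ShiftOperators M
  open OperatorDegrees M
  open KroneckerDelta M using (δ; δ-diag; δ-off)

  -- The matrix E · 1 − Y over the ring of shift operators.
  charMatrix : ℕ → ℕ → Op
  charMatrix r c = - Y r c ∷ δ r c ∷ []

  act-charMatrix : ∀ r c s i → act (charMatrix r c) s i ≈ᴹ δ r c *ₗ s (suc i) +ᴹ -ᴹ (Y r c *ₗ s i)
  act-charMatrix r c s i = begin
    (- Y r c) *ₗ s i +ᴹ (δ r c *ₗ s (suc i) +ᴹ 0ᴹ) ≈⟨ +ᴹ-cong (-‿distribˡ-*ₗ (Y r c) (s i)) (+ᴹ-identityʳ _) ⟩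
    -ᴹ (Y r c *ₗ s i) +ᴹ δ r c *ₗ s (suc i)        ≈⟨ +ᴹ-comm _ _ ⟩
    δ r c *ₗ s (suc i) +ᴹ -ᴹ (Y r c *ₗ s i)        ∎
    where open SetoidReasoning ≈ᴹ-setoid

  charMatrix-off-diagonal : ∀ {r c} → r ≢ c → Degree< 1 (charMatrix r c)
  charMatrix-off-diagonal {r} {c} r≢c = [ - Y r c ] , s≤s z≤n , mk≋ λ s i →
    +ᴹ-congˡ (≈ᴹ-trans (+ᴹ-identityʳ _) (δ-off r≢c (s (suc i))))

  charMatrix-diagonal : ∀ r → Monic 1 (charMatrix r r)
  charMatrix-diagonal r = [ - Y r r ] , s≤s z≤n , mk≋ λ s i →
    +ᴹ-cong (*ₗ-congʳ (CommutativeRing.sym R (+-identityʳ _)))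
            (+ᴹ-congʳ (≈ᴹ-trans (δ-diag r (s (suc i))) (≈ᴹ-sym (*ₗ-identityˡ _))))

  open Determinant operatorRing charMatrix
  open OperatorDeterminantDegree M charMatrix

  det-charMatrix-monic : ∀ n k → Monic n (det (range k n) (range k n))
  det-charMatrix-monic zero    k = [] , z≤n , CommutativeRing.refl operatorRing
  det-charMatrix-monic (suc n) k = Monic--ₒ
    (Monic-*ₒ (charMatrix-diagonal k) (det-charMatrix-monic n (suc k)))
    (Degree<-mono (≤-reflexive (≡.cong suc (length-range (suc k) n)))
      (expand-degree k (range (suc k) n) [ k ] (range (suc k) n)
        (det-degree (λ r c → Degree<-length (charMatrix r c)) (range (suc k) n))
        (λ c c∈ → charMatrix-off-diagonal (<⇒≢ (proj₁ (∈-range⁻ (suc k) n c∈))))))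

module LinearRecurrence {r ℓr m ℓm} {R : CommutativeRing r ℓr} (M : Module R m ℓm) where
  open import Data.Nat using (_+_; _∸_; _<_; _<?_; z≤n)
  open import Data.Nat.Properties using (+-assoc; +-identityʳ; +-monoʳ-<; m∸n+n≡m; ≮⇒≥)
  open import Data.Nat.Induction using (<-rec)
  open import Data.Fin using (Fin; toℕ)
  import Data.Fin as Fin
  open import Data.Empty using (⊥-elim)
  open import Relation.Nullary using (yes; no)
  import Algebra.Module.Construct.TensorUnit as TensorUnit
  open CommutativeRing R using (_*_; 0#) renaming (Carrier to K; ring to ringR)
  open Module M
  open LeftModuleProperties leftModule
  open KroneckerDelta M using (δ; ∑-δ)
  open SetoidReasoning ≈ᴹ-setoid

  ∑ᴿ : ∀ {i} {I : Set i} → List I → (I → K) → K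
  ∑ᴿ = LeftModuleProperties.∑ (TensorUnit.leftModule {R = ringR})

  ∑ᴿ-*ₗ : ∀ {i} {I : Set i} (L : List I) (g : I → K) x → ∑ᴿ L g *ₗ x ≈ᴹ ∑[ j ∈ L ] g j *ₗ x
  ∑ᴿ-*ₗ []      g x = *ₗ-zeroˡ x
  ∑ᴿ-*ₗ (j ∷ L) g x = ≈ᴹ-trans (*ₗ-distribʳ x _ _) (+ᴹ-congˡ (∑ᴿ-*ₗ L g x))

  ∑-∑-*ₗ : ∀ {i j} {I : Set i} {J : Set j} (L : List I) (L′ : List J) (g : I → K) (h : I → J → K) (x : J → Carrierᴹ) →
           ∑[ c ∈ L ] g c *ₗ (∑[ c′ ∈ L′ ] h c c′ *ₗ x c′) ≈ᴹ ∑[ c′ ∈ L′ ] ∑ᴿ L (λ c → g c * h c c′) *ₗ x c′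
  ∑-∑-*ₗ L L′ g h x = begin
    ∑[ c ∈ L ] g c *ₗ (∑[ c′ ∈ L′ ] h c c′ *ₗ x c′)      ≈⟨ ∑-cong L (λ c _ → *ₗ-distribˡ-∑ (g c) L′ _) ⟩
    ∑[ c ∈ L ] ∑[ c′ ∈ L′ ] g c *ₗ (h c c′ *ₗ x c′)     ≈⟨ ∑-cong L (λ c _ → ∑-cong L′ λ c′ _ → *ₗ-assoc _ _ _) ⟨
    ∑[ c ∈ L ] ∑[ c′ ∈ L′ ] (g c * h c c′) *ₗ x c′      ≈⟨ ∑-comm L L′ _ ⟩
    ∑[ c′ ∈ L′ ] ∑[ c ∈ L ] (g c * h c c′) *ₗ x c′      ≈⟨ ∑-cong L′ (λ c′ _ → ∑ᴿ-*ₗ L _ (x c′)) ⟨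
    ∑[ c′ ∈ L′ ] ∑ᴿ L (λ c → g c * h c c′) *ₗ x c′      ∎

  extendByZero : ∀ {d} → (Fin d → K) → ℕ → K
  extendByZero {zero}  γ _       = 0#
  extendByZero {suc d} γ zero    = γ Fin.zero
  extendByZero {suc d} γ (suc i) = extendByZero (λ j → γ (Fin.suc j)) i

  ∑-range-suc : ∀ k n f → ∑ (range (suc k) n) f ≈ᴹ ∑[ i ∈ range k n ] f (suc i)
  ∑-range-suc k zero    f = ≈ᴹ-refl
  ∑-range-suc k (suc n) f = +ᴹ-congˡ (∑-range-suc (suc k) n f)

  sumᴹ≈∑-range : ∀ d (γ : Fin d → K) (s : ℕ → Carrierᴹ) →
                 sumᴹ M d (λ j → γ j *ₗ s (toℕ j)) ≈ᴹ ∑[ i ∈ range 0 d ] extendByZero γ i *ₗ s i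
  sumᴹ≈∑-range zero    γ s = ≈ᴹ-refl
  sumᴹ≈∑-range (suc d) γ s = +ᴹ-congˡ (≈ᴹ-trans (sumᴹ≈∑-range d (λ j → γ (Fin.suc j)) (λ i → s (suc i)))
                                                (≈ᴹ-sym (∑-range-suc 0 d _)))

  order-0-vanishes : ∀ a → IsRecOfOrder≤ M a 0 → ∀ n → a n ≈ᴹ 0ᴹ
  order-0-vanishes a (_ , rec) n = ≈ᴹ-trans (≈ᴹ-reflexive (≡.cong a (≡.sym (+-identityʳ n)))) (rec n)

  module _ (a : ℕ → Carrierᴹ) {d} (isRec : IsRecOfOrder≤ M a d) where
    private
      γ = proj₁ isRec
      rec = proj₂ isRec

    InSpan : ℕ → Set (r ⊔ ℓm)
    InSpan N = Σ (ℕ → K) λ c → ∀ n → a (n + N) ≈ᴹ ∑[ j ∈ range 0 d ] c j *ₗ a (n + j)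

    -- Strong induction: a (n + N) = Σ γᵢ a (n + N - d + i), and each N - d + i < N is already in the span.
    shift-in-span : ∀ N → InSpan N
    shift-in-span = <-rec InSpan step
      where
      step : ∀ N → (∀ {N′} → N′ < N → InSpan N′) → InSpan N
      step N _ with N <? d
      ... | yes N<d = δ N , λ n → ≈ᴹ-sym (∑-δ 0 d (λ j → a (n + j)) z≤n N<d)
      step N below | no N≮d = c′ , a-in-span
        where
        N′ = N ∸ d
        N′+d≡N : N′ + d ≡ N
        N′+d≡N = m∸n+n≡m (≮⇒≥ N≮d)
        -- The no branch is never used for i < d; it only makes the coefficients a total function of i.
        coefficients : ∀ i → Σ (ℕ → K) λ c → N′ + i < N →
                       ∀ n → a (n + (N′ + i)) ≈ᴹ ∑[ j ∈ range 0 d ] c j *ₗ a (n + j)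
        coefficients i with N′ + i <? N
        ... | yes N′+i<N = proj₁ (below N′+i<N) , λ _ → proj₂ (below N′+i<N)
        ... | no  N′+i≮N = (λ _ → 0#) , λ N′+i<N → ⊥-elim (N′+i≮N N′+i<N)
        c′ : ℕ → K
        c′ j = ∑ᴿ (range 0 d) (λ i → extendByZero γ i * proj₁ (coefficients i) j)
        a-in-span : ∀ n → a (n + N) ≈ᴹ ∑[ j ∈ range 0 d ] c′ j *ₗ a (n + j)
        a-in-span n = begin
          a (n + N)
            ≈⟨ ≈ᴹ-reflexive (≡.cong a (≡.trans (≡.cong (n +_) (≡.sym N′+d≡N)) (≡.sym (+-assoc n N′ d)))) ⟩
          a (n + N′ + d)
            ≈⟨ rec (n + N′) ⟩
          sumᴹ M d (λ i → γ i *ₗ a (n + N′ + toℕ i))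
            ≈⟨ sumᴹ≈∑-range d γ (λ i → a (n + N′ + i)) ⟩
          ∑[ i ∈ range 0 d ] extendByZero γ i *ₗ a (n + N′ + i)
            ≈⟨ ∑-cong (range 0 d) (λ i i∈ → *ₗ-congˡ (≈ᴹ-trans (≈ᴹ-reflexive (≡.cong a (+-assoc n N′ i)))
                 (proj₂ (coefficients i) (≡.subst (N′ + i <_) N′+d≡N (+-monoʳ-< N′ (proj₂ (∈-range⁻ 0 d i∈)))) n))) ⟩
          ∑[ i ∈ range 0 d ] extendByZero γ i *ₗ (∑[ j ∈ range 0 d ] proj₁ (coefficients i) j *ₗ a (n + j))
            ≈⟨ ∑-∑-*ₗ (range 0 d) (range 0 d) (extendByZero γ) (λ i → proj₁ (coefficients i)) (λ j → a (n + j)) ⟩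
          ∑[ j ∈ range 0 d ] c′ j *ₗ a (n + j)
            ∎

module Decimation {r ℓr m ℓm} {R : CommutativeRing r ℓr} (M : Module R m ℓm) where
  open import Data.Nat using (_+_; _*_; z≤n)
  open import Data.Nat.Properties using (+-comm)
  open import Data.Nat.Tactic.RingSolver using (solve-∀)
  open CommutativeRing R using () renaming (Carrier to K)
  open Module M
  open LeftModuleProperties leftModule
  open ShiftOperators M
  open OperatorDegrees M
  open KroneckerDelta M using (δ; ∑-δ)
  open LinearRecurrence M
  open SetoidReasoning ≈ᴹ-setoid
  private module Seqs = LeftModuleProperties sequenceModule

  ∑-at : ∀ {i} {I : Set i} (L : List I) (f : I → Seq) j → Seqs.∑ L f j ≈ᴹ ∑[ c ∈ L ] f c j
  ∑-at []      f j = ≈ᴹ-refl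
  ∑-at (c ∷ L) f j = +ᴹ-congˡ (∑-at L f j)

  private
    index-shift : ∀ r k i step → r + (k + (step + i * step)) ≡ (k + i * step) + (step + r)
    index-shift = solve-∀

  module _ (a : ℕ → Carrierᴹ) {d′} (isRec : IsRecOfOrder≤ M a (suc d′)) (k step : ℕ) where
    private
      d = suc d′
      Y : ℕ → ℕ → K
      Y r c = proj₁ (shift-in-span a isRec (step + r)) c

    open CharacteristicMatrix M Y using (charMatrix; act-charMatrix; det-charMatrix-monic)

    w : ℕ → Seq
    w r i = a (r + (k + i * step))

    w-suc : ∀ r i → w r (suc i) ≈ᴹ ∑[ c ∈ range 0 d ] Y r c *ₗ w c i
    w-suc r i = begin
      a (r + (k + (step + i * step)))             ≈⟨ ≈ᴹ-reflexive (≡.cong a (index-shift r k i step)) ⟩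
      a ((k + i * step) + (step + r))             ≈⟨ proj₂ (shift-in-span a isRec (step + r)) (k + i * step) ⟩
      ∑[ c ∈ range 0 d ] Y r c *ₗ a ((k + i * step) + c)
        ≈⟨ ∑-cong (range 0 d) (λ c _ → *ₗ-congˡ (≈ᴹ-reflexive (≡.cong a (+-comm (k + i * step) c)))) ⟩
      ∑[ c ∈ range 0 d ] Y r c *ₗ w c i           ∎

    charMatrix-kills-w : ∀ r → r ∈ range 0 d → ∀ i →
                         Seqs.∑ (range 0 d) (λ c → act (charMatrix r c) (w c)) i ≈ᴹ 0ᴹ
    charMatrix-kills-w r r∈ i = begin
      Seqs.∑ (range 0 d) (λ c → act (charMatrix r c) (w c)) i
        ≈⟨ ∑-at (range 0 d) _ i ⟩
      ∑[ c ∈ range 0 d ] act (charMatrix r c) (w c) i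
        ≈⟨ ∑-cong (range 0 d) (λ c _ → act-charMatrix r c (w c) i) ⟩
      ∑[ c ∈ range 0 d ] (δ r c *ₗ w c (suc i) +ᴹ -ᴹ (Y r c *ₗ w c i))
        ≈⟨ ∑-distrib-+ᴹ (range 0 d) _ _ ⟩
      (∑[ c ∈ range 0 d ] δ r c *ₗ w c (suc i)) +ᴹ (∑[ c ∈ range 0 d ] -ᴹ (Y r c *ₗ w c i))
        ≈⟨ +ᴹ-cong (∑-δ 0 d (λ c → w c (suc i)) z≤n (proj₂ (∈-range⁻ 0 d r∈)))
                   (≈ᴹ-sym (-ᴹ‿distrib-∑ (range 0 d) _)) ⟩
      w r (suc i) +ᴹ -ᴹ (∑[ c ∈ range 0 d ] Y r c *ₗ w c i)
        ≈⟨ +ᴹ-congˡ (-ᴹ‿cong (w-suc r i)) ⟨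
      w r (suc i) +ᴹ -ᴹ w r (suc i)
        ≈⟨ -ᴹ‿inverseʳ _ ⟩
      0ᴹ ∎

    decimation-annihilator : Σ Op λ p → Monic d p × ∀ j → act p (λ i → a (k + i * step)) j ≈ᴹ 0ᴹ
    decimation-annihilator =
      det (range 0 d) (range 0 d) , det-charMatrix-monic d 0 ,
      det-annihilates-kernel (range 0 d) 0 (range 1 d′) w charMatrix-kills-w
      where
      open Determinant operatorRing charMatrix using (det)
      open Cramer operatorRing charMatrix sequenceModule using (det-annihilates-kernel)

open import Data.Nat using (_+_; _*_; _<_; NonZero)

corollary2p2 : {r ℓr m ℓm : Level} (R : CommutativeRing r ℓr) (M : Module R m ℓm)
    (a : ℕ → Module.Carrierᴹ M) (d : ℕ) → HasRecOrder M a d →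
    (k m : ℕ) → NonZero m →
    (∀ i → i < d → Module._≈ᴹ_ M (a (k + i * m)) (Module.0ᴹ M)) →
    ∀ i → Module._≈ᴹ_ M (a (k + i * m)) (Module.0ᴹ M)
corollary2p2 R M a zero     (isRec , _) k m _ _ i = LinearRecurrence.order-0-vanishes M a isRec (k + i * m)
corollary2p2 R M a (suc d′) (isRec , _) k m _ vanish-below
  with _ , monic , annihilates ← Decimation.decimation-annihilator M a isRec k m
  = OperatorDegrees.Monic-annihilator-vanishes M monic annihilates vanish-below
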